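{- For each $n\ge 0$, \[ \hat{B}_n(s,t)=\frac{1}{n!}\sum_{k=0}^n {n\brack k}\,\bigl|\mathrm{Bal}^s[k]\bigr|\,\bigl|\mathrm{Bal}^t[k]\bigr|. \]
   Context: A Burge matrix is a matrix with nonnegative integer entries in which every row and every column has a nonzero entry; its size is the sum of its entries; $\mathcal{M}[n]$ denotes the set of Burge matrices of size $n$. For indeterminates $s,t$, the two-sided Caylerian polynomial is $\hat{B}_n(s,t)=\sum_{A\in\mathcal{M}[n]}s^{\mathrm{row}(A)}t^{\mathrm{col}(A)}$, where $\mathrm{row}(A),\mathrm{col}(A)$ are the numbers of rows and columns of $A$. A ballot of $[k]=\{1,\dots,k\}$ is an ordered set partition, i.e. a sequence $B_1\cdots B_j$ of disjoint nonempty sets whose union is $[k]$, with $j$ its number of blocks; $|\mathrm{Bal}^t[k]|=\sum_{w}t^{\mathrm{blocks}(w)}$, the sum over all ballots $w$ of $[k]$. ${n\brack k}$ is the unsigned Stirling number of the first kind. -}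

module Defs where

open import Data.Bool using (Bool; true; false)
open import Data.Nat using (ℕ; zero; suc; _+_; _*_; _≟_)
open import Data.Nat using (_!)
open import Data.Nat.ListAction using () renaming (sum to listSum)
open import Data.List as List using (List; []; _∷_; length; filter; upTo; concatMap; map)
open import Data.Vec as Vec using (Vec; []; _∷_; transpose)
open import Data.Vec.Relation.Unary.All as VAll using (All; all?)
open import Data.Vec.Relation.Unary.Any as VAny using (Any; any?)
open import Data.Vec.Relation.Unary.AllPairs as VAllPairs using (AllPairs; allPairs?)
open import Data.Vec.Properties using (≡-dec)
open import Data.Bool.Properties using () renaming (_≟_ to _≟ᵇ_)
open import Data.Fin.Subset using (Subset; Nonempty; _∩_; _∪_; ⊥; ⊤)
open import Data.Fin.Subset.Properties using (nonempty?)
open import Data.Product using (_×_; _,_)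
open import Relation.Nullary using (¬_; ¬?)
open import Relation.Nullary.Decidable using (_×-dec_)
open import Relation.Binary.PropositionalEquality using (_≡_; _≢_)
open import Relation.Unary using (Decidable)

vecsOver : {A : Set} → List A → (m : ℕ) → List (Vec A m)
vecsOver xs zero    = [] ∷ []
vecsOver xs (suc m) = concatMap (λ x → map (x ∷_) (vecsOver xs m)) xs

range : ℕ → List ℕ
range n = upTo (suc n)

-- Burge matrices: nonnegative integer matrices (here: r rows, c columns,
-- given as a vector of rows) with every row and every column containing a
-- nonzero entry.  Size = sum of entries.

Matrix : ℕ → ℕ → Set
Matrix r c = Vec (Vec ℕ c) r

size : {r c : ℕ} → Matrix r c → ℕ
size A = Vec.sum (Vec.map Vec.sum A)

HasNonzero : {c : ℕ} → Vec ℕ c → Set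
HasNonzero v = Any (λ x → x ≢ 0) v

IsBurge : (n : ℕ) {r c : ℕ} → Matrix r c → Set
IsBurge n A = (All HasNonzero A × All HasNonzero (transpose A)) × size A ≡ n

isBurge? : (n : ℕ) {r c : ℕ} → Decidable (IsBurge n {r} {c})
isBurge? n A =
  (all? (λ v → any? (λ x → ¬? (x ≟ 0)) v) A
   ×-dec all? (λ v → any? (λ x → ¬? (x ≟ 0)) v) (transpose A))
  ×-dec (size A ≟ n)

-- All r × c matrices with entries in {0,…,n}; every matrix of size n is
-- among them (entries are bounded by the size).
boundedMatrices : (n r c : ℕ) → List (Matrix r c)
boundedMatrices n r c = vecsOver (vecsOver (range n) c) r

-- Number of Burge matrices of size n with r rows and c columns,
-- i.e. the coefficient of s^r t^c in the two-sided Caylerian polynomial B̂_n(s,t).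
burgeCount : (n r c : ℕ) → ℕ
burgeCount n r c = length (filter (isBurge? n) (boundedMatrices n r c))

-- Ballots (ordered set partitions) of [k] with j blocks:
-- a sequence B_1 ⋯ B_j of nonempty, pairwise disjoint subsets of [k]
-- whose union is [k].

Disjoint : {k : ℕ} → Subset k → Subset k → Set
Disjoint p q = p ∩ q ≡ ⊥

union : {k j : ℕ} → Vec (Subset k) j → Subset k
union = Vec.foldr _ _∪_ ⊥

IsBallot : {k j : ℕ} → Vec (Subset k) j → Set
IsBallot bs = (All Nonempty bs × AllPairs Disjoint bs) × union bs ≡ ⊤

isBallot? : {k j : ℕ} → Decidable (IsBallot {k} {j})
isBallot? bs =
  (all? nonempty? bs
   ×-dec allPairs? (λ p q → ≡-dec _≟ᵇ_ (p ∩ q) ⊥) bs)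
  ×-dec ≡-dec _≟ᵇ_ (union bs) ⊤

allSubsetSeqs : (k j : ℕ) → List (Vec (Subset k) j)
allSubsetSeqs k j = vecsOver (vecsOver (true ∷ false ∷ []) k) j

-- Number of ballots of [k] with j blocks,
-- i.e. the coefficient of t^j in |Bal^t[k]|.
ballotCount : (k j : ℕ) → ℕ
ballotCount k j = length (filter isBallot? (allSubsetSeqs k j))

stirling1 : ℕ → ℕ → ℕ
stirling1 zero    zero    = 1
stirling1 zero    (suc k) = 0
stirling1 (suc n) zero    = 0
stirling1 (suc n) (suc k) = n * stirling1 n (suc k) + stirling1 n k

sumTo : ℕ → (ℕ → ℕ) → ℕ
sumTo n f = listSum (map f (range n))

-- The two sides are compared through their binomial transforms in r and c.  Summing n! · burgeCount n i j
-- against (r C i) (c C j) counts n! times all r × c matrices of size n (deleting the zero rows and columns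
-- of such a matrix leaves a Burge matrix), that is, n! times the weak compositions of n into r c parts; this
-- is the rising factorial r c (r c + 1) ⋯ (r c + n - 1) = Σ_k [n k] (r c)^k.  Likewise Σ_j (m C j) · ballotCount k j
-- = m^k counts the maps [k] → [m] grouped by their image, so (r c)^k = r^k c^k is the transform of
-- ballotCount k i · ballotCount k j.  The binomial transform is invertible (its matrix is unitriangular).
module Submission where

open import Defs
open import Data.Bool using (Bool; true; false; if_then_else_)
open import Data.Empty using (⊥-elim)
open import Data.List using (List; []; _∷_; _++_; map; concatMap; filter; length; applyUpTo)
open import Data.Nat using (ℕ; zero; suc; _+_; _*_; _^_; _!; _≤_; _<_; z≤n; s≤s; _≟_)
open import Data.Nat.Combinatorics using (_C_; nCn≡1; k>n⇒nCk≡0; nCk+nC[k+1]≡[n+1]C[k+1])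
open import Data.Nat.ListAction using () renaming (sum to listSum)
open import Data.Nat.Properties
open import Data.Nat.Tactic.RingSolver using (solve-∀)
open import Algebra.Properties.CommutativeSemigroup +-commutativeSemigroup using () renaming (interchange to +-interchange)
open import Algebra.Properties.CommutativeSemigroup *-commutativeSemigroup
  using (x∙yz≈y∙xz; x∙yz≈yx∙z) renaming (interchange to *-interchange)
open import Data.Product using (_×_; _,_)
open import Data.Sum using (inj₁; inj₂)
open import Data.Vec as Vec using (Vec; []; _∷_; transpose; zipWith; replicate; concat)
open import Data.Vec.Properties using (zipWith-is-⊛; zipWith-replicate₁; map-id; map-cong; map-replicate; sum-++; ∷-injectiveʳ)
open import Data.Vec.Relation.Unary.All using (All; []; _∷_; all?)
open import Function using (_∘_; id; _⇔_; mk⇔; Equivalence)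
open import Relation.Binary.PropositionalEquality
open import Relation.Nullary using (Dec; yes; no; does; ¬_; ¬?; contradiction)
open import Relation.Nullary.Decidable using (_×-dec_)
open import Relation.Unary using (Pred; Decidable)

private variable
  A B : Set
  P Q : Set

∑ : List A → (A → ℕ) → ℕ
∑ []       f = 0
∑ (x ∷ xs) f = f x + ∑ xs f

syntax ∑ xs (λ x → e) = ∑[ x ∈ xs ] e

∑-cong : ∀ (xs : List A) {f g : A → ℕ} → (∀ x → f x ≡ g x) → ∑ xs f ≡ ∑ xs g
∑-cong []       f≗g = refl
∑-cong (x ∷ xs) f≗g = cong₂ _+_ (f≗g x) (∑-cong xs f≗g)

∑-zero : ∀ (xs : List A) → ∑[ x ∈ xs ] 0 ≡ 0
∑-zero []       = refl
∑-zero (x ∷ xs) = ∑-zero xs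

∑-distrib-+ : ∀ (xs : List A) (f g : A → ℕ) → ∑[ x ∈ xs ] (f x + g x) ≡ ∑ xs f + ∑ xs g
∑-distrib-+ []       f g = refl
∑-distrib-+ (x ∷ xs) f g = begin
  f x + g x + ∑[ y ∈ xs ] (f y + g y) ≡⟨ cong (f x + g x +_) (∑-distrib-+ xs f g) ⟩
  f x + g x + (∑ xs f + ∑ xs g)        ≡⟨ +-interchange (f x) (g x) _ _ ⟩
  f x + ∑ xs f + (g x + ∑ xs g)        ∎
  where open ≡-Reasoning

∑-*ˡ : ∀ (xs : List A) a (f : A → ℕ) → ∑[ x ∈ xs ] (a * f x) ≡ a * ∑ xs f
∑-*ˡ []       a f = sym (*-zeroʳ a)
∑-*ˡ (x ∷ xs) a f = trans (cong (a * f x +_) (∑-*ˡ xs a f)) (sym (*-distribˡ-+ a (f x) _))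

∑-*ʳ : ∀ (xs : List A) a (f : A → ℕ) → ∑[ x ∈ xs ] (f x * a) ≡ ∑ xs f * a
∑-*ʳ xs a f = trans (∑-cong xs (λ x → *-comm (f x) a)) (trans (∑-*ˡ xs a f) (*-comm a _))

∑-++ : ∀ (xs ys : List A) f → ∑ (xs ++ ys) f ≡ ∑ xs f + ∑ ys f
∑-++ []       ys f = refl
∑-++ (x ∷ xs) ys f = trans (cong (f x +_) (∑-++ xs ys f)) (sym (+-assoc (f x) _ _))

∑-comm : ∀ (xs : List A) (ys : List B) (f : A → B → ℕ) →
         ∑[ x ∈ xs ] ∑[ y ∈ ys ] f x y ≡ ∑[ y ∈ ys ] ∑[ x ∈ xs ] f x y
∑-comm []       ys f = sym (∑-zero ys)
∑-comm (x ∷ xs) ys f = trans (cong (∑ ys (f x) +_) (∑-comm xs ys f)) (sym (∑-distrib-+ ys (f x) _))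

∑-map : ∀ (xs : List A) (h : A → B) f → ∑ (map h xs) f ≡ ∑ xs (f ∘ h)
∑-map []       h f = refl
∑-map (x ∷ xs) h f = cong (f (h x) +_) (∑-map xs h f)

∑-concatMap : ∀ (xs : List A) (g : A → List B) f → ∑ (concatMap g xs) f ≡ ∑[ x ∈ xs ] ∑ (g x) f
∑-concatMap []       g f = refl
∑-concatMap (x ∷ xs) g f = trans (∑-++ (g x) (concatMap g xs) f) (cong (∑ (g x) f +_) (∑-concatMap xs g f))

sum-map≡∑ : ∀ (xs : List A) f → listSum (map f xs) ≡ ∑ xs f
sum-map≡∑ []       f = refl
sum-map≡∑ (x ∷ xs) f = cong (f x +_) (sum-map≡∑ xs f)

∑-vecsOver : ∀ (xs : List A) m (f : Vec A (suc m) → ℕ) →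
             ∑ (vecsOver xs (suc m)) f ≡ ∑[ x ∈ xs ] ∑[ v ∈ vecsOver xs m ] f (x ∷ v)
∑-vecsOver xs m f = trans (∑-concatMap xs _ f) (∑-cong xs (λ x → ∑-map (vecsOver xs m) (x ∷_) f))

𝟙 : Dec P → ℕ
𝟙 d = if does d then 1 else 0

length-filter≡∑𝟙 : ∀ {P : Pred A _} (P? : Decidable P) (xs : List A) →
                   length (filter P? xs) ≡ ∑[ x ∈ xs ] 𝟙 (P? x)
length-filter≡∑𝟙 P? []       = refl
length-filter≡∑𝟙 P? (x ∷ xs) with P? x
... | yes _ = cong suc (length-filter≡∑𝟙 P? xs)
... | no  _ = length-filter≡∑𝟙 P? xs

𝟙-× : (d : Dec P) (e : Dec Q) → 𝟙 (d ×-dec e) ≡ 𝟙 d * 𝟙 e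
𝟙-× (yes _) (yes _) = refl
𝟙-× (yes _) (no  _) = refl
𝟙-× (no  _) _       = refl

𝟙-⇔ : P ⇔ Q → (d : Dec P) (e : Dec Q) → 𝟙 d ≡ 𝟙 e
𝟙-⇔ P⇔Q (yes p) (yes q) = refl
𝟙-⇔ P⇔Q (yes p) (no ¬q) = contradiction (Equivalence.to P⇔Q p) ¬q
𝟙-⇔ P⇔Q (no ¬p) (yes q) = contradiction (Equivalence.from P⇔Q q) ¬p
𝟙-⇔ P⇔Q (no ¬p) (no ¬q) = refl

∑≤ : ℕ → (ℕ → ℕ) → ℕ
∑≤ zero    f = f 0
∑≤ (suc n) f = ∑≤ n f + f (suc n)

syntax ∑≤ n (λ i → e) = ∑[ i ≤ n ] e

∑≤-cong-≤ : ∀ n {f g : ℕ → ℕ} → (∀ i → i ≤ n → f i ≡ g i) → ∑≤ n f ≡ ∑≤ n g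
∑≤-cong-≤ zero    f≗g = f≗g 0 z≤n
∑≤-cong-≤ (suc n) f≗g = cong₂ _+_ (∑≤-cong-≤ n (λ i i≤n → f≗g i (m≤n⇒m≤1+n i≤n))) (f≗g (suc n) ≤-refl)

∑≤-cong : ∀ n {f g : ℕ → ℕ} → (∀ i → f i ≡ g i) → ∑≤ n f ≡ ∑≤ n g
∑≤-cong n f≗g = ∑≤-cong-≤ n (λ i _ → f≗g i)

∑≤-suc-shift : ∀ n f → ∑≤ (suc n) f ≡ f 0 + ∑≤ n (f ∘ suc)
∑≤-suc-shift zero    f = refl
∑≤-suc-shift (suc n) f = trans (cong (_+ f (suc (suc n))) (∑≤-suc-shift n f)) (+-assoc (f 0) _ _)

∑≤-distrib-+ : ∀ n (f g : ℕ → ℕ) → ∑[ i ≤ n ] (f i + g i) ≡ ∑≤ n f + ∑≤ n g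
∑≤-distrib-+ zero    f g = refl
∑≤-distrib-+ (suc n) f g =
  trans (cong (_+ (f (suc n) + g (suc n))) (∑≤-distrib-+ n f g)) (+-interchange (∑≤ n f) _ _ _)

∑≤-*ˡ : ∀ n a (f : ℕ → ℕ) → ∑[ i ≤ n ] (a * f i) ≡ a * ∑≤ n f
∑≤-*ˡ zero    a f = refl
∑≤-*ˡ (suc n) a f = trans (cong (_+ a * f (suc n)) (∑≤-*ˡ n a f)) (sym (*-distribˡ-+ a _ _))

∑≤-*ʳ : ∀ n a (f : ℕ → ℕ) → ∑[ i ≤ n ] (f i * a) ≡ ∑≤ n f * a
∑≤-*ʳ n a f = trans (∑≤-cong n (λ i → *-comm (f i) a)) (trans (∑≤-*ˡ n a f) (*-comm a _))

∑≤-comm : ∀ n m (f : ℕ → ℕ → ℕ) → ∑[ i ≤ n ] ∑[ j ≤ m ] f i j ≡ ∑[ j ≤ m ] ∑[ i ≤ n ] f i j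
∑≤-comm zero    m f = refl
∑≤-comm (suc n) m f = trans (cong (_+ ∑≤ m (f (suc n))) (∑≤-comm n m f)) (sym (∑≤-distrib-+ m _ _))

∑≤-∑-comm : ∀ n (xs : List A) (f : ℕ → A → ℕ) → ∑[ i ≤ n ] ∑ xs (f i) ≡ ∑[ x ∈ xs ] ∑[ i ≤ n ] f i x
∑≤-∑-comm zero    xs f = refl
∑≤-∑-comm (suc n) xs f = trans (cong (_+ ∑ xs (f (suc n))) (∑≤-∑-comm n xs f)) (sym (∑-distrib-+ xs _ _))

∑-applyUpTo : ∀ n (g : ℕ → ℕ) f → ∑ (applyUpTo g (suc n)) f ≡ ∑≤ n (f ∘ g)
∑-applyUpTo zero    g f = +-identityʳ _
∑-applyUpTo (suc n) g f =
  trans (cong (f (g 0) +_) (∑-applyUpTo n (g ∘ suc) f)) (sym (∑≤-suc-shift n (f ∘ g)))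

∑-range : ∀ n f → ∑ (range n) f ≡ ∑≤ n f
∑-range n = ∑-applyUpTo n id

sumTo≡∑≤ : ∀ n f → sumTo n f ≡ ∑≤ n f
sumTo≡∑≤ n f = trans (sum-map≡∑ (range n) f) (∑-range n f)

[_≡0] : ℕ → ℕ
[ zero  ≡0] = 1
[ suc _ ≡0] = 0

[_≢0] : ℕ → ℕ
[ zero  ≢0] = 0
[ suc _ ≢0] = 1

[≡0]+[≢0] : ∀ n y → y ≡ [ n ≡0] * y + [ n ≢0] * y
[≡0]+[≢0] zero    y = sym (trans (+-identityʳ _) (+-identityʳ y))
[≡0]+[≢0] (suc n) y = sym (+-identityʳ _)

[≡0]-+ : ∀ a b → [ a + b ≡0] ≡ [ a ≡0] * [ b ≡0]
[≡0]-+ zero    b = sym (+-identityʳ _)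
[≡0]-+ (suc a) b = refl

𝟙[≟0]≡[≡0] : ∀ n → 𝟙 (n ≟ 0) ≡ [ n ≡0]
𝟙[≟0]≡[≡0] zero    = refl
𝟙[≟0]≡[≡0] (suc n) = refl

𝟙≡[≢0] : ∀ {n} → P ⇔ (n ≢ 0) → (d : Dec P) → 𝟙 d ≡ [ n ≢0]
𝟙≡[≢0] {n = zero}  P⇔n≢0 d = 𝟙-⇔ P⇔n≢0 d (no (λ 0≢0 → 0≢0 refl))
𝟙≡[≢0] {n = suc n} P⇔n≢0 d = 𝟙-⇔ P⇔n≢0 d (yes (λ ()))

𝟙-no : ¬ P → (d : Dec P) → 𝟙 d ≡ 0
𝟙-no ¬p (yes p) = contradiction p ¬p
𝟙-no ¬p (no _)  = refl

binomialTransform : (ℕ → ℕ) → ℕ → ℕ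
binomialTransform f m = ∑[ j ≤ m ] ((m C j) * f j)

binomialTransform-cong : ∀ {f g : ℕ → ℕ} → (∀ j → f j ≡ g j) → ∀ m → binomialTransform f m ≡ binomialTransform g m
binomialTransform-cong f≗g m = ∑≤-cong m (λ j → cong ((m C j) *_) (f≗g j))

binomialTransform-suc : ∀ f m →
  binomialTransform f (suc m) ≡ binomialTransform f m + binomialTransform (f ∘ suc) m
binomialTransform-suc f m = begin
  ∑[ j ≤ suc m ] ((suc m C j) * f j)
    ≡⟨ ∑≤-suc-shift m _ ⟩
  1 * f 0 + ∑[ j ≤ m ] ((suc m C suc j) * f (suc j))
    ≡⟨ cong (1 * f 0 +_) (∑≤-cong m (λ j → cong (_* f (suc j)) (sym (nCk+nC[k+1]≡[n+1]C[k+1] m j)))) ⟩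
  1 * f 0 + ∑[ j ≤ m ] (((m C j) + (m C suc j)) * f (suc j))
    ≡⟨ cong (1 * f 0 +_) (trans (∑≤-cong m (λ j → *-distribʳ-+ (f (suc j)) (m C j) _)) (∑≤-distrib-+ m _ _)) ⟩
  1 * f 0 + (binomialTransform (f ∘ suc) m + ∑[ j ≤ m ] ((m C suc j) * f (suc j)))
    ≡⟨ +-rotate (1 * f 0) _ _ ⟩
  1 * f 0 + ∑[ j ≤ m ] ((m C suc j) * f (suc j)) + binomialTransform (f ∘ suc) m
    ≡⟨ cong (_+ binomialTransform (f ∘ suc) m) (sym (∑≤-suc-shift m _)) ⟩
  binomialTransform f m + (m C suc m) * f (suc m) + binomialTransform (f ∘ suc) m
    ≡⟨ cong (λ t → binomialTransform f m + t * f (suc m) + binomialTransform (f ∘ suc) m)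
            (k>n⇒nCk≡0 {m} {suc m} (n<1+n m)) ⟩
  binomialTransform f m + 0 + binomialTransform (f ∘ suc) m
    ≡⟨ cong (_+ binomialTransform (f ∘ suc) m) (+-identityʳ _) ⟩
  binomialTransform f m + binomialTransform (f ∘ suc) m ∎
  where
  open ≡-Reasoning
  +-rotate : ∀ a b c → a + (b + c) ≡ a + c + b
  +-rotate = solve-∀

binomialTransform-injective : ∀ {f g : ℕ → ℕ} →
  (∀ m → binomialTransform f m ≡ binomialTransform g m) → ∀ m → f m ≡ g m
binomialTransform-injective {f} {g} Tf≗Tg m = agreeUpTo m m ≤-refl
  where
  diagonalTerm : ∀ h m → (suc m C suc m) * h (suc m) ≡ h (suc m)
  diagonalTerm h m = trans (cong (_* h (suc m)) (nCn≡1 (suc m))) (*-identityˡ _)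

  agreeUpTo : ∀ m j → j ≤ m → f j ≡ g j
  agreeUpTo zero    zero z≤n = trans (sym (+-identityʳ (f 0))) (trans (Tf≗Tg 0) (+-identityʳ (g 0)))
  agreeUpTo (suc m) j j≤1+m with m≤n⇒m<n∨m≡n j≤1+m
  ... | inj₁ (s≤s j≤m) = agreeUpTo m j j≤m
  ... | inj₂ refl = begin
    f (suc m)                     ≡⟨ diagonalTerm f m ⟨
    (suc m C suc m) * f (suc m)   ≡⟨ +-cancelˡ-≡ _ _ _ lowerTermsAgree ⟩
    (suc m C suc m) * g (suc m)   ≡⟨ diagonalTerm g m ⟩
    g (suc m)                     ∎
    where
    open ≡-Reasoning
    lowerTermsAgree : ∑[ i ≤ m ] ((suc m C i) * g i) + (suc m C suc m) * f (suc m)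
                    ≡ ∑[ i ≤ m ] ((suc m C i) * g i) + (suc m C suc m) * g (suc m)
    lowerTermsAgree = trans (cong (_+ _) (sym (∑≤-cong-≤ m (λ i i≤m → cong ((suc m C i) *_) (agreeUpTo m i i≤m)))))
                            (Tf≗Tg (suc m))

binomialTransform-*ˡ : ∀ a f m → binomialTransform (λ j → a * f j) m ≡ a * binomialTransform f m
binomialTransform-*ˡ a f m = trans (∑≤-cong m (λ j → x∙yz≈y∙xz (m C j) a (f j))) (∑≤-*ˡ m a _)

binomialTransform-∑≤ : ∀ n (F : ℕ → ℕ → ℕ) m →
  binomialTransform (λ j → ∑[ k ≤ n ] F k j) m ≡ ∑[ k ≤ n ] binomialTransform (F k) m
binomialTransform-∑≤ n F m =
  trans (∑≤-cong m (λ j → sym (∑≤-*ˡ n (m C j) _))) (∑≤-comm m n _)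

binomialTransform-∑ : ∀ (xs : List A) (F : ℕ → A → ℕ) m →
  binomialTransform (λ j → ∑ xs (F j)) m ≡ ∑[ x ∈ xs ] binomialTransform (λ j → F j x) m
binomialTransform-∑ xs F m =
  trans (∑≤-cong m (λ j → sym (∑-*ˡ xs (m C j) _))) (∑≤-∑-comm m xs _)

binomialTransform₂ : (ℕ → ℕ → ℕ) → ℕ → ℕ → ℕ
binomialTransform₂ X r c = binomialTransform (λ i → binomialTransform (X i) c) r

binomialTransform₂-cong : ∀ {X Y : ℕ → ℕ → ℕ} → (∀ i j → X i j ≡ Y i j) → ∀ r c →
  binomialTransform₂ X r c ≡ binomialTransform₂ Y r c
binomialTransform₂-cong X≗Y r c = binomialTransform-cong (λ i → binomialTransform-cong (X≗Y i) c) r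

binomialTransform₂-injective : ∀ {X Y : ℕ → ℕ → ℕ} →
  (∀ r c → binomialTransform₂ X r c ≡ binomialTransform₂ Y r c) → ∀ r c → X r c ≡ Y r c
binomialTransform₂-injective TX≗TY r c =
  binomialTransform-injective (λ c′ → binomialTransform-injective (λ r′ → TX≗TY r′ c′) r) c

binomialTransform₂-*ˡ : ∀ a X r c →
  binomialTransform₂ (λ i j → a * X i j) r c ≡ a * binomialTransform₂ X r c
binomialTransform₂-*ˡ a X r c = trans
  (binomialTransform-cong (λ i → binomialTransform-*ˡ a (X i) c) r)
  (binomialTransform-*ˡ a _ r)

binomialTransform₂-separable : ∀ n (w : ℕ → ℕ) (f g : ℕ → ℕ → ℕ) r c →
  binomialTransform₂ (λ i j → ∑[ k ≤ n ] (w k * f k i * g k j)) r c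
    ≡ ∑[ k ≤ n ] (w k * binomialTransform (f k) r * binomialTransform (g k) c)
binomialTransform₂-separable n w f g r c = begin
  binomialTransform (λ i → binomialTransform (λ j → ∑[ k ≤ n ] (w k * f k i * g k j)) c) r
    ≡⟨ binomialTransform-cong (λ i → binomialTransform-∑≤ n _ c) r ⟩
  binomialTransform (λ i → ∑[ k ≤ n ] binomialTransform (λ j → w k * f k i * g k j) c) r
    ≡⟨ binomialTransform-∑≤ n _ r ⟩
  ∑[ k ≤ n ] binomialTransform (λ i → binomialTransform (λ j → w k * f k i * g k j) c) r
    ≡⟨ ∑≤-cong n (λ k → trans (binomialTransform-cong (λ i → binomialTransform-cong (λ j → *-assoc (w k) _ _) c) r)
                               (binomialTransform₂-*ˡ (w k) _ r c)) ⟩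
  ∑[ k ≤ n ] (w k * binomialTransform₂ (λ i j → f k i * g k j) r c)
    ≡⟨ ∑≤-cong n (λ k → cong (w k *_) (product k)) ⟩
  ∑[ k ≤ n ] (w k * (binomialTransform (f k) r * binomialTransform (g k) c))
    ≡⟨ ∑≤-cong n (λ k → sym (*-assoc (w k) _ _)) ⟩
  ∑[ k ≤ n ] (w k * binomialTransform (f k) r * binomialTransform (g k) c) ∎
  where
  open ≡-Reasoning
  product : ∀ k → binomialTransform₂ (λ i j → f k i * g k j) r c
                ≡ binomialTransform (f k) r * binomialTransform (g k) c
  product k = trans (binomialTransform-cong (λ i → binomialTransform-*ˡ (f k i) (g k) c) r)
    (trans (∑≤-cong r (λ i → sym (*-assoc (r C i) _ _))) (∑≤-*ʳ r _ _))

^-distribʳ-* : ∀ a b k → (a * b) ^ k ≡ a ^ k * b ^ k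
^-distribʳ-* a b zero    = refl
^-distribʳ-* a b (suc k) = trans (cong (a * b *_) (^-distribʳ-* a b k)) (*-interchange a b (a ^ k) (b ^ k))

rising : ℕ → ℕ → ℕ
rising m zero    = 1
rising m (suc n) = rising m n * (m + n)

stirling1-vanishes : ∀ {n k} → n < k → stirling1 n k ≡ 0
stirling1-vanishes {zero}  {suc k} _ = refl
stirling1-vanishes {suc n} {suc k} (s≤s n<k) =
  trans (cong₂ (λ a b → n * a + b) (stirling1-vanishes (m<n⇒m<1+n n<k)) (stirling1-vanishes n<k))
        (cong (_+ 0) (*-zeroʳ n))

n*stirling1[n,0]≡0 : ∀ n → n * stirling1 n 0 ≡ 0
n*stirling1[n,0]≡0 zero    = refl
n*stirling1[n,0]≡0 (suc n) = *-zeroʳ (suc n)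

∑-stirling1-pow : ∀ n m → ∑[ k ≤ n ] (stirling1 n k * m ^ k) ≡ rising m n
∑-stirling1-pow zero    m = refl
∑-stirling1-pow (suc n) m = begin
  ∑[ k ≤ suc n ] (stirling1 (suc n) k * m ^ k)
    ≡⟨ ∑≤-suc-shift n _ ⟩
  0 + ∑[ k ≤ n ] ((n * stirling1 n (suc k) + stirling1 n k) * m ^ suc k)
    ≡⟨ trans (∑≤-cong n (λ k → distribute n (stirling1 n (suc k)) (stirling1 n k) m (m ^ k))) (∑≤-distrib-+ n _ _) ⟩
  ∑[ k ≤ n ] (n * term (suc k)) + ∑[ k ≤ n ] (m * term k)
    ≡⟨ cong₂ _+_ (trans (∑≤-*ˡ n n (term ∘ suc)) shifted) (trans (∑≤-*ˡ n m term) (cong (m *_) (∑-stirling1-pow n m))) ⟩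
  n * rising m n + m * rising m n
    ≡⟨ collect n m (rising m n) ⟩
  rising m n * (m + n) ∎
  where
  open ≡-Reasoning
  term : ℕ → ℕ
  term k = stirling1 n k * m ^ k

  distribute : ∀ n a b m x → (n * a + b) * (m * x) ≡ n * (a * (m * x)) + m * (b * x)
  distribute = solve-∀
  collect : ∀ n m x → n * x + m * x ≡ x * (m + n)
  collect = solve-∀

  -- the index shift is harmless because n · [n 0] = 0 and [n n+1] = 0
  shifted : n * ∑≤ n (term ∘ suc) ≡ n * rising m n
  shifted = begin
    n * ∑≤ n (term ∘ suc)
      ≡⟨ cong (_+ n * ∑≤ n (term ∘ suc)) (trans (cong (n *_) (*-identityʳ _)) (n*stirling1[n,0]≡0 n)) ⟨
    n * term 0 + n * ∑≤ n (term ∘ suc)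
      ≡⟨ trans (cong (n *_) (∑≤-suc-shift n term)) (*-distribˡ-+ n _ _) ⟨
    n * ∑≤ (suc n) term
      ≡⟨ cong (λ s → n * (∑≤ n term + s * m ^ suc n)) (stirling1-vanishes (n<1+n n)) ⟩
    n * (∑≤ n term + 0)
      ≡⟨ cong (n *_) (trans (+-identityʳ _) (∑-stirling1-pow n m)) ⟩
    n * rising m n ∎

rising-suc : ∀ m n → rising m (suc n) ≡ m * rising (suc m) n
rising-suc m zero    = trans (+-identityʳ (m + 0)) (trans (+-identityʳ m) (sym (*-identityʳ m)))
rising-suc m (suc n) = trans (cong (_* (m + suc n)) (rising-suc m n)) (reassociate m (rising (suc m) n) n)
  where
  reassociate : ∀ m x n → m * x * (m + suc n) ≡ m * (x * (suc m + n))
  reassociate = solve-∀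

rising-pascal : ∀ m n → rising (suc m) (suc n) ≡ suc n * rising (suc m) n + rising m (suc n)
rising-pascal m n =
  trans (split m n (rising (suc m) n)) (cong (suc n * rising (suc m) n +_) (sym (rising-suc m n)))
  where
  split : ∀ m n x → x * (suc m + n) ≡ suc n * x + m * x
  split = solve-∀

Matrices : List A → (r c : ℕ) → List (Vec (Vec A c) r)
Matrices xs r c = vecsOver (vecsOver xs c) r

empty-unique : (v : Vec A 0) → v ≡ []
empty-unique [] = refl

transpose-∷ : ∀ {r c} (v : Vec A c) (B : Vec (Vec A c) r) → transpose (v ∷ B) ≡ zipWith _∷_ v (transpose B)
transpose-∷ v B = sym (zipWith-is-⊛ _∷_ v (transpose B))

transpose-zipWith-∷ : ∀ {r c} (v : Vec A c) (T : Vec (Vec A r) c) → transpose (zipWith _∷_ v T) ≡ v ∷ transpose T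
transpose-zipWith-∷ []      []      = refl
transpose-zipWith-∷ (x ∷ v) (t ∷ T) = begin
  transpose ((x ∷ t) ∷ zipWith _∷_ v T)             ≡⟨ transpose-∷ (x ∷ t) (zipWith _∷_ v T) ⟩
  zipWith _∷_ (x ∷ t) (transpose (zipWith _∷_ v T)) ≡⟨ cong (zipWith _∷_ (x ∷ t)) (transpose-zipWith-∷ v T) ⟩
  (x ∷ v) ∷ zipWith _∷_ t (transpose T)             ≡⟨ cong ((x ∷ v) ∷_) (transpose-∷ t T) ⟨
  (x ∷ v) ∷ transpose (t ∷ T)                       ∎
  where open ≡-Reasoning

transpose-involutive : ∀ {r c} (B : Vec (Vec A c) r) → transpose (transpose B) ≡ B
transpose-involutive []      = empty-unique _
transpose-involutive (v ∷ B) = begin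
  transpose (transpose (v ∷ B))             ≡⟨ cong transpose (transpose-∷ v B) ⟩
  transpose (zipWith _∷_ v (transpose B))   ≡⟨ transpose-zipWith-∷ v (transpose B) ⟩
  v ∷ transpose (transpose B)               ≡⟨ cong (v ∷_) (transpose-involutive B) ⟩
  v ∷ B                                     ∎
  where open ≡-Reasoning

module _ (xs : List A) where

  ∑-zipWith-∷ : ∀ c r (g : Vec (Vec A (suc r)) c → ℕ) →
    ∑[ v ∈ vecsOver xs c ] ∑[ T ∈ Matrices xs c r ] g (zipWith _∷_ v T) ≡ ∑ (Matrices xs c (suc r)) g
  ∑-zipWith-∷ zero    r g = +-identityʳ _
  ∑-zipWith-∷ (suc c) r g = begin
    ∑[ v ∈ V (suc c) ] ∑[ T ∈ Matrices xs (suc c) r ] g (zipWith _∷_ v T)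
      ≡⟨ ∑-vecsOver xs c _ ⟩
    ∑[ x ∈ xs ] ∑[ v ∈ V c ] ∑[ T ∈ Matrices xs (suc c) r ] g (zipWith _∷_ (x ∷ v) T)
      ≡⟨ ∑-cong xs (λ x → ∑-cong (V c) (λ v → ∑-vecsOver (V r) c _)) ⟩
    ∑[ x ∈ xs ] ∑[ v ∈ V c ] ∑[ t ∈ V r ] ∑[ T ∈ Matrices xs c r ] g ((x ∷ t) ∷ zipWith _∷_ v T)
      ≡⟨ ∑-cong xs (λ x → ∑-comm (V c) (V r) _) ⟩
    ∑[ x ∈ xs ] ∑[ t ∈ V r ] ∑[ v ∈ V c ] ∑[ T ∈ Matrices xs c r ] g ((x ∷ t) ∷ zipWith _∷_ v T)
      ≡⟨ ∑-cong xs (λ x → ∑-cong (V r) (λ t → ∑-zipWith-∷ c r (λ B → g ((x ∷ t) ∷ B)))) ⟩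
    ∑[ x ∈ xs ] ∑[ t ∈ V r ] ∑[ B ∈ Matrices xs c (suc r) ] g ((x ∷ t) ∷ B)
      ≡⟨ ∑-vecsOver xs r _ ⟨
    ∑[ b ∈ V (suc r) ] ∑[ B ∈ Matrices xs c (suc r) ] g (b ∷ B)
      ≡⟨ ∑-vecsOver (V (suc r)) c _ ⟨
    ∑ (Matrices xs (suc c) (suc r)) g ∎
    where
    open ≡-Reasoning
    V : (m : ℕ) → List (Vec A m)
    V = vecsOver xs

  ∑-Matrices-no-columns : ∀ c (g : Vec (Vec A 0) c → ℕ) → ∑ (Matrices xs c 0) g ≡ g (replicate c [])
  ∑-Matrices-no-columns zero    g = +-identityʳ _
  ∑-Matrices-no-columns (suc c) g =
    trans (∑-vecsOver (vecsOver xs 0) c g) (trans (+-identityʳ _) (∑-Matrices-no-columns c (λ B → g ([] ∷ B))))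

  ∑-transpose : ∀ r c (f : Vec (Vec A c) r → ℕ) → ∑ (Matrices xs r c) f ≡ ∑ (Matrices xs c r) (f ∘ transpose)
  ∑-transpose zero    c f = begin
    f [] + 0                                 ≡⟨ +-identityʳ _ ⟩
    f []                                     ≡⟨ cong f (empty-unique _) ⟨
    f (transpose (replicate c []))           ≡⟨ ∑-Matrices-no-columns c (f ∘ transpose) ⟨
    ∑ (Matrices xs c 0) (f ∘ transpose)      ∎
    where open ≡-Reasoning
  ∑-transpose (suc r) c f = begin
    ∑ (Matrices xs (suc r) c) f
      ≡⟨ ∑-vecsOver (vecsOver xs c) r f ⟩
    ∑[ v ∈ vecsOver xs c ] ∑[ B ∈ Matrices xs r c ] f (v ∷ B)
      ≡⟨ ∑-cong (vecsOver xs c) (λ v → ∑-transpose r c (λ B → f (v ∷ B))) ⟩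
    ∑[ v ∈ vecsOver xs c ] ∑[ T ∈ Matrices xs c r ] f (v ∷ transpose T)
      ≡⟨ ∑-cong (vecsOver xs c) (λ v → ∑-cong (Matrices xs c r) (λ T → cong f (transpose-zipWith-∷ v T))) ⟨
    ∑[ v ∈ vecsOver xs c ] ∑[ T ∈ Matrices xs c r ] f (transpose (zipWith _∷_ v T))
      ≡⟨ ∑-zipWith-∷ c r (f ∘ transpose) ⟩
    ∑ (Matrices xs c (suc r)) (f ∘ transpose) ∎
    where open ≡-Reasoning

  ∑-vecsOver-++ : ∀ a b (f : Vec A (a + b) → ℕ) →
    ∑ (vecsOver xs (a + b)) f ≡ ∑[ u ∈ vecsOver xs a ] ∑[ v ∈ vecsOver xs b ] f (u Vec.++ v)
  ∑-vecsOver-++ zero    b f = sym (+-identityʳ _)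
  ∑-vecsOver-++ (suc a) b f = begin
    ∑ (vecsOver xs (suc a + b)) f
      ≡⟨ ∑-vecsOver xs (a + b) f ⟩
    ∑[ x ∈ xs ] ∑[ w ∈ vecsOver xs (a + b) ] f (x ∷ w)
      ≡⟨ ∑-cong xs (λ x → ∑-vecsOver-++ a b (λ w → f (x ∷ w))) ⟩
    ∑[ x ∈ xs ] ∑[ u ∈ vecsOver xs a ] ∑[ v ∈ vecsOver xs b ] f (x ∷ u Vec.++ v)
      ≡⟨ ∑-vecsOver xs a _ ⟨
    ∑[ u ∈ vecsOver xs (suc a) ] ∑[ v ∈ vecsOver xs b ] f (u Vec.++ v) ∎
    where open ≡-Reasoning

  ∑-Matrices-concat : ∀ r c (f : Vec A (r * c) → ℕ) →
    ∑[ B ∈ Matrices xs r c ] f (concat B) ≡ ∑ (vecsOver xs (r * c)) f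
  ∑-Matrices-concat zero    c f = refl
  ∑-Matrices-concat (suc r) c f = begin
    ∑[ B ∈ Matrices xs (suc r) c ] f (concat B)
      ≡⟨ ∑-vecsOver (vecsOver xs c) r _ ⟩
    ∑[ u ∈ vecsOver xs c ] ∑[ B ∈ Matrices xs r c ] f (u Vec.++ concat B)
      ≡⟨ ∑-cong (vecsOver xs c) (λ u → ∑-Matrices-concat r c (λ v → f (u Vec.++ v))) ⟩
    ∑[ u ∈ vecsOver xs c ] ∑[ v ∈ vecsOver xs (r * c) ] f (u Vec.++ v)
      ≡⟨ ∑-vecsOver-++ c (r * c) f ⟨
    ∑ (vecsOver xs (suc r * c)) f ∎
    where open ≡-Reasoning

sum-zipWith-+ : ∀ {c} (u v : Vec ℕ c) → Vec.sum (zipWith _+_ u v) ≡ Vec.sum u + Vec.sum v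
sum-zipWith-+ []      []      = refl
sum-zipWith-+ (x ∷ u) (y ∷ v) = trans (cong (x + y +_) (sum-zipWith-+ u v)) (+-interchange x y _ _)

sum-replicate-0 : ∀ c → Vec.sum (replicate c 0) ≡ 0
sum-replicate-0 zero    = refl
sum-replicate-0 (suc c) = sum-replicate-0 c

zipWith-+-replicate-0 : ∀ {c} (u : Vec ℕ c) → zipWith _+_ (replicate c 0) u ≡ u
zipWith-+-replicate-0 u = trans (zipWith-replicate₁ _+_ 0 u) (map-id u)

-- Entries of type A carry weights w, and row weights, column sums and the total are taken after
-- weighting: Burge matrices are the case A = ℕ, w = id; a ballot is a 0/1 matrix whose rows are
-- the blocks (A = Bool, w = bit).
module WeightedMatrices {A : Set} (xs : List A) (w : A → ℕ) where

  weight : ∀ {c} → Vec A c → ℕ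
  weight v = Vec.sum (Vec.map w v)

  colSums : ∀ {r c} → Vec (Vec A c) r → Vec ℕ c
  colSums {c = c} []        = replicate c 0
  colSums         (v ∷ B)   = zipWith _+_ (Vec.map w v) (colSums B)

  allNonzero : ∀ {c} → Vec ℕ c → ℕ
  allNonzero []      = 1
  allNonzero (x ∷ u) = [ x ≢0] * allNonzero u

  nonzeroRows : ∀ {r c} → Vec (Vec A c) r → ℕ
  nonzeroRows B = allNonzero (Vec.map weight B)

  nonzeroCols : ∀ {r c} → Vec (Vec A c) r → ℕ
  nonzeroCols B = allNonzero (colSums B)

  total : ∀ {r c} → Vec (Vec A c) r → ℕ
  total B = Vec.sum (colSums B)

  colSums-zipWith-∷ : ∀ {r c} (v : Vec A c) (T : Vec (Vec A r) c) →
                      colSums (zipWith _∷_ v T) ≡ weight v ∷ colSums T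
  colSums-zipWith-∷ []      []      = refl
  colSums-zipWith-∷ (x ∷ v) (t ∷ T) rewrite colSums-zipWith-∷ v T = refl

  colSums-transpose : ∀ {r c} (B : Vec (Vec A c) r) → colSums (transpose B) ≡ Vec.map weight B
  colSums-transpose []      = empty-unique _
  colSums-transpose (v ∷ B) = begin
    colSums (transpose (v ∷ B))              ≡⟨ cong colSums (transpose-∷ v B) ⟩
    colSums (zipWith _∷_ v (transpose B))    ≡⟨ colSums-zipWith-∷ v (transpose B) ⟩
    weight v ∷ colSums (transpose B)         ≡⟨ cong (weight v ∷_) (colSums-transpose B) ⟩
    weight v ∷ Vec.map weight B              ∎
    where open ≡-Reasoning

  nonzeroRows-transpose : ∀ {r c} (B : Vec (Vec A c) r) → nonzeroRows (transpose B) ≡ nonzeroCols B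
  nonzeroRows-transpose B = begin
    allNonzero (Vec.map weight (transpose B))      ≡⟨ cong allNonzero (colSums-transpose (transpose B)) ⟨
    allNonzero (colSums (transpose (transpose B))) ≡⟨ cong (allNonzero ∘ colSums) (transpose-involutive B) ⟩
    allNonzero (colSums B)                         ∎
    where open ≡-Reasoning

  total≡sum-weights : ∀ {r c} (B : Vec (Vec A c) r) → total B ≡ Vec.sum (Vec.map weight B)
  total≡sum-weights {c = c} []      = sum-replicate-0 c
  total≡sum-weights         (v ∷ B) =
    trans (sum-zipWith-+ (Vec.map w v) (colSums B)) (cong (weight v +_) (total≡sum-weights B))

  total-transpose : ∀ {r c} (B : Vec (Vec A c) r) → total (transpose B) ≡ total B
  total-transpose B = trans (cong Vec.sum (colSums-transpose B)) (sym (total≡sum-weights B))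

  weight≡0⇒zeros : ∀ {c} (v : Vec A c) → weight v ≡ 0 → Vec.map w v ≡ replicate c 0
  weight≡0⇒zeros []      _   = refl
  weight≡0⇒zeros (x ∷ v) w≡0 = cong₂ _∷_ (m+n≡0⇒m≡0 (w x) w≡0) (weight≡0⇒zeros v (m+n≡0⇒n≡0 (w x) w≡0))

  [weight≡0]-* : ∀ {c} (v : Vec A c) (g : Vec ℕ c → ℕ) →
                 [ weight v ≡0] * g (Vec.map w v) ≡ [ weight v ≡0] * g (replicate c 0)
  [weight≡0]-* v g with weight v in eq
  ... | zero  = cong (λ u → 1 * g u) (weight≡0⇒zeros v eq)
  ... | suc _ = refl

  module _ (uniqueZero : ∑[ x ∈ xs ] [ w x ≡0] ≡ 1) where

    ∑-[weight≡0] : ∀ c → ∑[ v ∈ vecsOver xs c ] [ weight v ≡0] ≡ 1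
    ∑-[weight≡0] zero    = refl
    ∑-[weight≡0] (suc c) = begin
      ∑[ v ∈ vecsOver xs (suc c) ] [ weight v ≡0]
        ≡⟨ ∑-vecsOver xs c _ ⟩
      ∑[ x ∈ xs ] ∑[ v ∈ vecsOver xs c ] [ w x + weight v ≡0]
        ≡⟨ ∑-cong xs (λ x → ∑-cong (vecsOver xs c) (λ v → [≡0]-+ (w x) (weight v))) ⟩
      ∑[ x ∈ xs ] ∑[ v ∈ vecsOver xs c ] ([ w x ≡0] * [ weight v ≡0])
        ≡⟨ ∑-cong xs (λ x → trans (∑-*ˡ (vecsOver xs c) [ w x ≡0] _) (cong ([ w x ≡0] *_) (∑-[weight≡0] c))) ⟩
      ∑[ x ∈ xs ] ([ w x ≡0] * 1)
        ≡⟨ trans (∑-cong xs (λ x → *-identityʳ _)) uniqueZero ⟩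
      1 ∎
      where open ≡-Reasoning

    ∑-[weight≡0]-* : ∀ c (g : Vec ℕ c → ℕ) →
                     ∑[ v ∈ vecsOver xs c ] ([ weight v ≡0] * g (Vec.map w v)) ≡ g (replicate c 0)
    ∑-[weight≡0]-* c g = begin
      ∑[ v ∈ vecsOver xs c ] ([ weight v ≡0] * g (Vec.map w v))     ≡⟨ ∑-cong (vecsOver xs c) (λ v → [weight≡0]-* v g) ⟩
      ∑[ v ∈ vecsOver xs c ] ([ weight v ≡0] * g (replicate c 0))   ≡⟨ ∑-*ʳ (vecsOver xs c) _ _ ⟩
      ∑[ v ∈ vecsOver xs c ] [ weight v ≡0] * g (replicate c 0)     ≡⟨ cong (_* g (replicate c 0)) (∑-[weight≡0] c) ⟩
      1 * g (replicate c 0)                                          ≡⟨ *-identityˡ _ ⟩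
      g (replicate c 0)                                              ∎
      where open ≡-Reasoning

    -- Sort the matrices by the set of their nonzero rows: deleting the zero rows leaves a matrix
    -- with i nonzero rows and the same column sums, and the zero rows can sit in r C i places.
    ∑-colSums≡binomialTransform : ∀ r c (h : Vec ℕ c → ℕ) →
      ∑[ B ∈ Matrices xs r c ] h (colSums B)
        ≡ binomialTransform (λ i → ∑[ B ∈ Matrices xs i c ] (nonzeroRows B * h (colSums B))) r
    ∑-colSums≡binomialTransform zero    c h = units (h (replicate c 0))
      where
      units : ∀ x → x + 0 ≡ 1 * (1 * x + 0)
      units = solve-∀
    ∑-colSums≡binomialTransform (suc r) c h = begin
      ∑[ B ∈ Matrices xs (suc r) c ] h (colSums B)
        ≡⟨ ∑-vecsOver (vecsOver xs c) r _ ⟩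
      ∑[ v ∈ vecsOver xs c ] ∑[ B ∈ Matrices xs r c ] h (zipWith _+_ (Vec.map w v) (colSums B))
        ≡⟨ ∑-cong (vecsOver xs c) (λ v → ∑-colSums≡binomialTransform r c (h ∘ zipWith _+_ (Vec.map w v))) ⟩
      ∑[ v ∈ vecsOver xs c ] F (Vec.map w v)
        ≡⟨ ∑-cong (vecsOver xs c) (λ v → [≡0]+[≢0] (weight v) (F (Vec.map w v))) ⟩
      ∑[ v ∈ vecsOver xs c ] ([ weight v ≡0] * F (Vec.map w v) + [ weight v ≢0] * F (Vec.map w v))
        ≡⟨ ∑-distrib-+ (vecsOver xs c) _ _ ⟩
      ∑[ v ∈ vecsOver xs c ] ([ weight v ≡0] * F (Vec.map w v)) + ∑[ v ∈ vecsOver xs c ] ([ weight v ≢0] * F (Vec.map w v))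
        ≡⟨ cong₂ _+_ (trans (∑-[weight≡0]-* c F) zeroFirstRow) nonzeroFirstRow ⟩
      binomialTransform T r + binomialTransform (T ∘ suc) r
        ≡⟨ binomialTransform-suc T r ⟨
      binomialTransform T (suc r) ∎
      where
      open ≡-Reasoning

      T : ℕ → ℕ
      T i = ∑[ B ∈ Matrices xs i c ] (nonzeroRows B * h (colSums B))

      G : ℕ → Vec ℕ c → ℕ
      G i u = ∑[ B ∈ Matrices xs i c ] (nonzeroRows B * h (zipWith _+_ u (colSums B)))

      F : Vec ℕ c → ℕ
      F u = binomialTransform (λ i → G i u) r

      zeroFirstRow : F (replicate c 0) ≡ binomialTransform T r
      zeroFirstRow = binomialTransform-cong
        (λ i → ∑-cong (Matrices xs i c) (λ B → cong (λ u → nonzeroRows B * h u) (zipWith-+-replicate-0 (colSums B)))) r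

      absorbFirstRow : ∀ i v → [ weight v ≢0] * G i (Vec.map w v)
                             ≡ ∑[ B ∈ Matrices xs i c ] (nonzeroRows (v ∷ B) * h (colSums (v ∷ B)))
      absorbFirstRow i v = trans (sym (∑-*ˡ (Matrices xs i c) [ weight v ≢0] _))
        (∑-cong (Matrices xs i c) (λ B → sym (*-assoc [ weight v ≢0] (nonzeroRows B) _)))

      nonzeroFirstRow : ∑[ v ∈ vecsOver xs c ] ([ weight v ≢0] * F (Vec.map w v)) ≡ binomialTransform (T ∘ suc) r
      nonzeroFirstRow = begin
        ∑[ v ∈ vecsOver xs c ] ([ weight v ≢0] * F (Vec.map w v))
          ≡⟨ ∑-cong (vecsOver xs c) (λ v → binomialTransform-*ˡ [ weight v ≢0] _ r) ⟨
        ∑[ v ∈ vecsOver xs c ] binomialTransform (λ i → [ weight v ≢0] * G i (Vec.map w v)) r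
          ≡⟨ binomialTransform-∑ (vecsOver xs c) _ r ⟨
        binomialTransform (λ i → ∑[ v ∈ vecsOver xs c ] ([ weight v ≢0] * G i (Vec.map w v))) r
          ≡⟨ binomialTransform-cong (λ i → ∑-cong (vecsOver xs c) (λ v → absorbFirstRow i v)) r ⟩
        binomialTransform (λ i → ∑[ v ∈ vecsOver xs c ] ∑[ B ∈ Matrices xs i c ] (nonzeroRows (v ∷ B) * h (colSums (v ∷ B)))) r
          ≡⟨ binomialTransform-cong (λ i → ∑-vecsOver (vecsOver xs c) i _) r ⟨
        binomialTransform (T ∘ suc) r ∎

    ∑-nonzeroRows≡binomialTransform : ∀ r c (g : ℕ → ℕ) →
      ∑[ B ∈ Matrices xs r c ] (nonzeroRows B * g (total B))
        ≡ binomialTransform (λ j → ∑[ B ∈ Matrices xs r j ] (nonzeroRows B * nonzeroCols B * g (total B))) c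
    ∑-nonzeroRows≡binomialTransform r c g = begin
      ∑[ B ∈ Matrices xs r c ] (nonzeroRows B * g (total B))
        ≡⟨ ∑-transpose xs r c _ ⟩
      ∑[ B ∈ Matrices xs c r ] (nonzeroRows (transpose B) * g (total (transpose B)))
        ≡⟨ ∑-cong (Matrices xs c r) (λ B → cong₂ (λ a t → a * g t) (nonzeroRows-transpose B) (total-transpose B)) ⟩
      ∑[ B ∈ Matrices xs c r ] h (colSums B)
        ≡⟨ ∑-colSums≡binomialTransform c r h ⟩
      binomialTransform (λ j → ∑[ B ∈ Matrices xs j r ] (nonzeroRows B * h (colSums B))) c
        ≡⟨ binomialTransform-cong (λ j → trans (∑-transpose xs j r _) (∑-cong (Matrices xs r j) transposed)) c ⟩
      binomialTransform (λ j → ∑[ B ∈ Matrices xs r j ] (nonzeroRows B * nonzeroCols B * g (total B))) c ∎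
      where
      open ≡-Reasoning

      h : ∀ {k} → Vec ℕ k → ℕ
      h u = allNonzero u * g (Vec.sum u)

      transposed : ∀ {j} (B : Vec (Vec A j) r) →
        nonzeroRows (transpose B) * h (colSums (transpose B)) ≡ nonzeroRows B * nonzeroCols B * g (total B)
      transposed B = begin
        nonzeroRows (transpose B) * (allNonzero (colSums (transpose B)) * g (total (transpose B)))
          ≡⟨ cong₂ (λ a b → a * (allNonzero b * g (total (transpose B)))) (nonzeroRows-transpose B) (colSums-transpose B) ⟩
        nonzeroCols B * (nonzeroRows B * g (total (transpose B)))
          ≡⟨ cong (λ t → nonzeroCols B * (nonzeroRows B * g t)) (total-transpose B) ⟩
        nonzeroCols B * (nonzeroRows B * g (total B))
          ≡⟨ x∙yz≈yx∙z (nonzeroCols B) (nonzeroRows B) _ ⟩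
        nonzeroRows B * nonzeroCols B * g (total B) ∎

    ∑-total≡binomialTransform₂ : ∀ r c (g : ℕ → ℕ) →
      ∑[ B ∈ Matrices xs r c ] g (total B)
        ≡ binomialTransform₂ (λ i j → ∑[ B ∈ Matrices xs i j ] (nonzeroRows B * nonzeroCols B * g (total B))) r c
    ∑-total≡binomialTransform₂ r c g = trans
      (∑-colSums≡binomialTransform r c (g ∘ Vec.sum))
      (binomialTransform-cong (λ i → ∑-nonzeroRows≡binomialTransform i c g) r)

range-uniqueZero : ∀ N → ∑[ x ∈ range N ] [ x ≡0] ≡ 1
range-uniqueZero N = trans (∑-range N [_≡0]) (∑≤[≡0] N)
  where
  ∑≤[≡0] : ∀ N → ∑[ x ≤ N ] [ x ≡0] ≡ 1
  ∑≤[≡0] zero    = refl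
  ∑≤[≡0] (suc N) = trans (+-identityʳ _) (∑≤[≡0] N)

compositions : (N n m : ℕ) → ℕ
compositions N n m = ∑[ v ∈ vecsOver (range N) m ] 𝟙 (Vec.sum v ≟ n)

compositions-zero : ∀ N m → compositions N 0 m ≡ 1
compositions-zero N m = trans
  (∑-cong (vecsOver (range N) m) (λ v → trans (𝟙[≟0]≡[≡0] (Vec.sum v)) (cong [_≡0] (cong Vec.sum (sym (map-id v))))))
  (WeightedMatrices.∑-[weight≡0] (range N) id (range-uniqueZero N) m)

-- Split off the first entry x: x = 0 leaves a composition of n + 1 into m parts, and x + 1 a composition
-- of n into m + 1 parts starting with x, where x = N is too large to occur.
compositions-pascal : ∀ {N n} m → suc n ≤ N → compositions N (suc n) (suc m) ≡ compositions N n (suc m) + compositions N (suc n) m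
compositions-pascal {suc K} {n} m (s≤s n≤K) = begin
  compositions (suc K) (suc n) (suc m)
    ≡⟨ trans (∑-vecsOver (range (suc K)) m _) (∑-range (suc K) first) ⟩
  ∑≤ (suc K) first
    ≡⟨ ∑≤-suc-shift K first ⟩
  compositions (suc K) (suc n) m + ∑≤ K rest
    ≡⟨ +-comm _ (∑≤ K rest) ⟩
  ∑≤ K rest + compositions (suc K) (suc n) m
    ≡⟨ cong (_+ compositions (suc K) (suc n) m) (trans (sym (+-identityʳ _)) (cong (∑≤ K rest +_) (sym restVanishes))) ⟩
  ∑≤ (suc K) rest + compositions (suc K) (suc n) m
    ≡⟨ cong (_+ compositions (suc K) (suc n) m) (sym (trans (∑-vecsOver (range (suc K)) m _) (∑-range (suc K) rest))) ⟩
  compositions (suc K) n (suc m) + compositions (suc K) (suc n) m ∎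
  where
  open ≡-Reasoning
  first rest : ℕ → ℕ
  first x = ∑[ v ∈ vecsOver (range (suc K)) m ] 𝟙 (x + Vec.sum v ≟ suc n)
  rest  x = ∑[ v ∈ vecsOver (range (suc K)) m ] 𝟙 (x + Vec.sum v ≟ n)

  restVanishes : rest (suc K) ≡ 0
  restVanishes = trans (∑-cong (vecsOver (range (suc K)) m) (λ v → 𝟙-no (overshoot v) (suc K + Vec.sum v ≟ n)))
                       (∑-zero (vecsOver (range (suc K)) m))
    where
    overshoot : ∀ v → suc K + Vec.sum v ≢ n
    overshoot v eq = <⇒≢ (s≤s (≤-trans n≤K (m≤m+n K (Vec.sum v)))) (sym eq)

factorial*compositions : ∀ {N} m n → n ≤ N → n ! * compositions N n m ≡ rising m n
factorial*compositions zero    zero    _ = refl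
factorial*compositions zero    (suc n) _ = trans (*-zeroʳ (suc n !)) (sym (rising-suc 0 n))
factorial*compositions (suc m) zero    _ = trans (+-identityʳ _) (compositions-zero _ (suc m))
factorial*compositions {N} (suc m) (suc n) n<N = begin
  suc n ! * compositions N (suc n) (suc m)
    ≡⟨ cong (suc n ! *_) (compositions-pascal m n<N) ⟩
  suc n ! * (compositions N n (suc m) + compositions N (suc n) m)
    ≡⟨ *-distribˡ-+ (suc n !) _ _ ⟩
  suc n ! * compositions N n (suc m) + suc n ! * compositions N (suc n) m
    ≡⟨ cong₂ _+_ (trans (*-assoc (suc n) (n !) _) (cong (suc n *_) (factorial*compositions (suc m) n (<⇒≤ n<N))))
                 (factorial*compositions m (suc n) n<N) ⟩
  suc n * rising (suc m) n + rising m (suc n)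
    ≡⟨ rising-pascal m n ⟨
  rising (suc m) (suc n) ∎
  where open ≡-Reasoning


module Ballots where

  open import Data.Fin using (zero; suc)
  open import Data.Fin.Subset using (Subset; Nonempty; _∩_; _∪_; ⊥; ⊤; _∈_)
  open import Data.Fin.Subset.Properties using (nonempty?; ∩-zeroʳ; ∩-distribˡ-∪; ∪-idem; p⊆p∪q; q⊆p∪q; Empty-unique; ∉⊥)
  open import Data.Vec using (here; there)
  open import Data.Vec.Relation.Unary.AllPairs using (AllPairs; []; _∷_)

  bit : Bool → ℕ
  bit true  = 1
  bit false = 0

  bools : List Bool
  bools = true ∷ false ∷ []

  open WeightedMatrices bools bit

  isNonzero : ℕ → Bool
  isNonzero zero    = false
  isNonzero (suc _) = true

  support : ∀ {k} → Vec ℕ k → Subset k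
  support = Vec.map isNonzero

  AtMostOne : ∀ {k} → Vec ℕ k → Set
  AtMostOne = All (_≤ 1)

  ∪≡⊥⇔ : ∀ {k} (p q : Subset k) → p ∪ q ≡ ⊥ ⇔ (p ≡ ⊥ × q ≡ ⊥)
  ∪≡⊥⇔ p q = mk⇔ (λ p∪q≡⊥ → below (p⊆p∪q q) p∪q≡⊥ , below (q⊆p∪q p q) p∪q≡⊥)
                  (λ { (refl , refl) → ∪-idem ⊥ })
    where
    below : ∀ {s} → (∀ {x} → x ∈ s → x ∈ p ∪ q) → p ∪ q ≡ ⊥ → s ≡ ⊥
    below s⊆ p∪q≡⊥ = Empty-unique (λ { (x , x∈s) → ∉⊥ (subst (x ∈_) p∪q≡⊥ (s⊆ x∈s)) })

  Disjoint-∪ : ∀ {k} (p q r : Subset k) → Disjoint p (q ∪ r) ⇔ (Disjoint p q × Disjoint p r)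
  Disjoint-∪ p q r = mk⇔
    (λ p∩[q∪r]≡⊥ → Equivalence.to (∪≡⊥⇔ (p ∩ q) (p ∩ r)) (trans (sym (∩-distribˡ-∪ p q r)) p∩[q∪r]≡⊥))
    (λ disjoint → trans (∩-distribˡ-∪ p q r) (Equivalence.from (∪≡⊥⇔ (p ∩ q) (p ∩ r)) disjoint))

  All-Disjoint⇔Disjoint-union : ∀ {j k} (p : Subset k) (B : Vec (Subset k) j) → All (Disjoint p) B ⇔ Disjoint p (union B)
  All-Disjoint⇔Disjoint-union p []      = mk⇔ (λ _ → ∩-zeroʳ p) (λ _ → [])
  All-Disjoint⇔Disjoint-union p (q ∷ B) = mk⇔
    (λ { (p#q ∷ p#B) → Equivalence.from (Disjoint-∪ p q (union B)) (p#q , Equivalence.to (All-Disjoint⇔Disjoint-union p B) p#B) })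
    (λ p#q∪B → let (p#q , p#∪B) = Equivalence.to (Disjoint-∪ p q (union B)) p#q∪B
               in p#q ∷ Equivalence.from (All-Disjoint⇔Disjoint-union p B) p#∪B)

  ∪-support : ∀ {k} (p : Subset k) (u : Vec ℕ k) → p ∪ support u ≡ support (zipWith _+_ (Vec.map bit p) u)
  ∪-support []           []      = refl
  ∪-support (true  ∷ p) (x ∷ u) = cong (true ∷_) (∪-support p u)
  ∪-support (false ∷ p) (x ∷ u) = cong (isNonzero x ∷_) (∪-support p u)

  union≡support-colSums : ∀ {j k} (B : Vec (Subset k) j) → union B ≡ support (colSums B)
  union≡support-colSums {k = k} []      = sym (map-replicate isNonzero 0 k)
  union≡support-colSums         (p ∷ B) = trans (cong (p ∪_) (union≡support-colSums B)) (∪-support p (colSums B))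

  Disjoint-support⇔AtMostOne : ∀ {k} (p : Subset k) (u : Vec ℕ k) →
    (Disjoint p (support u) × AtMostOne u) ⇔ AtMostOne (zipWith _+_ (Vec.map bit p) u)
  Disjoint-support⇔AtMostOne p u = mk⇔ (λ (p#u , u≤1) → to p u p#u u≤1) (λ p+u≤1 → from p u p+u≤1)
    where
    to : ∀ {k} (p : Subset k) (u : Vec ℕ k) → Disjoint p (support u) → AtMostOne u → AtMostOne (zipWith _+_ (Vec.map bit p) u)
    to []          []          _    []          = []
    to (true  ∷ p) (zero  ∷ u) p#u  (_   ∷ u≤1) = ≤-refl ∷ to p u (∷-injectiveʳ p#u) u≤1
    to (false ∷ p) (x     ∷ u) p#u  (x≤1 ∷ u≤1) = x≤1 ∷ to p u (∷-injectiveʳ p#u) u≤1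
    to (true  ∷ p) (suc x ∷ u) ()   _

    from : ∀ {k} (p : Subset k) (u : Vec ℕ k) → AtMostOne (zipWith _+_ (Vec.map bit p) u) → Disjoint p (support u) × AtMostOne u
    from []          []          []        = refl , []
    from (true  ∷ p) (zero  ∷ u) (_ ∷ p+u≤1) = let (p#u , u≤1) = from p u p+u≤1 in cong (false ∷_) p#u , z≤n ∷ u≤1
    from (true  ∷ p) (suc x ∷ u) (s≤s () ∷ _)
    from (false ∷ p) (x     ∷ u) (x≤1 ∷ p+u≤1) = let (p#u , u≤1) = from p u p+u≤1 in cong (false ∷_) p#u , x≤1 ∷ u≤1

  AllPairs-Disjoint⇔AtMostOne-colSums : ∀ {j k} (B : Vec (Subset k) j) → AllPairs Disjoint B ⇔ AtMostOne (colSums B)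
  AllPairs-Disjoint⇔AtMostOne-colSums {k = k} [] = mk⇔ (λ _ → zeros≤1 k) (λ _ → [])
    where
    zeros≤1 : ∀ k → AtMostOne (replicate k 0)
    zeros≤1 zero    = []
    zeros≤1 (suc k) = z≤n ∷ zeros≤1 k
  AllPairs-Disjoint⇔AtMostOne-colSums (p ∷ B) = mk⇔
    (λ { (p#B ∷ disjointB) → Equivalence.to (Disjoint-support⇔AtMostOne p (colSums B))
           (subst (Disjoint p) (union≡support-colSums B) (Equivalence.to (All-Disjoint⇔Disjoint-union p B) p#B) ,
            Equivalence.to (AllPairs-Disjoint⇔AtMostOne-colSums B) disjointB) })
    (λ p+B≤1 → let (p#B , B≤1) = Equivalence.from (Disjoint-support⇔AtMostOne p (colSums B)) p+B≤1
               in Equivalence.from (All-Disjoint⇔Disjoint-union p B) (subst (Disjoint p) (sym (union≡support-colSums B)) p#B)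
                  ∷ Equivalence.from (AllPairs-Disjoint⇔AtMostOne-colSums B) B≤1)

  AtMostOne×support≡⊤⇔All≡1 : ∀ {k} (u : Vec ℕ k) → (AtMostOne u × support u ≡ ⊤) ⇔ All (_≡ 1) u
  AtMostOne×support≡⊤⇔All≡1 u = mk⇔ (λ (u≤1 , full) → to u u≤1 full) (from u)
    where
    to : ∀ {k} (u : Vec ℕ k) → AtMostOne u → support u ≡ ⊤ → All (_≡ 1) u
    to []           []          _    = []
    to (suc zero ∷ u) (_ ∷ u≤1)  full = refl ∷ to u u≤1 (∷-injectiveʳ full)
    to (zero ∷ u)   _            ()
    to (suc (suc x) ∷ u) (s≤s () ∷ _) _

    from : ∀ {k} (u : Vec ℕ k) → All (_≡ 1) u → AtMostOne u × support u ≡ ⊤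
    from []      []           = [] , refl
    from (x ∷ u) (refl ∷ u≡1) = let (u≤1 , full) = from u u≡1 in ≤-refl ∷ u≤1 , cong (true ∷_) full

  IsBallot⇔ : ∀ {j k} (B : Vec (Subset k) j) → IsBallot B ⇔ (All Nonempty B × All (_≡ 1) (colSums B))
  IsBallot⇔ B = mk⇔
    (λ ((nonempty , disjoint) , covering) → nonempty ,
       Equivalence.to (AtMostOne×support≡⊤⇔All≡1 (colSums B))
         (Equivalence.to (AllPairs-Disjoint⇔AtMostOne-colSums B) disjoint , trans (sym (union≡support-colSums B)) covering))
    (λ (nonempty , ones) → let (B≤1 , full) = Equivalence.from (AtMostOne×support≡⊤⇔All≡1 (colSums B)) ones
       in (nonempty , Equivalence.from (AllPairs-Disjoint⇔AtMostOne-colSums B) B≤1) , trans (union≡support-colSums B) full)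

  Nonempty⇔weight≢0 : ∀ {k} (p : Subset k) → Nonempty p ⇔ (weight p ≢ 0)
  Nonempty⇔weight≢0 p = mk⇔ (λ (i , i∈p) → to p i∈p) (from p)
    where
    to : ∀ {k} (p : Subset k) {i} → i ∈ p → weight p ≢ 0
    to (true  ∷ p) here        ()
    to (true  ∷ p) (there i∈p) ()
    to (false ∷ p) (there i∈p) = to p i∈p

    from : ∀ {k} (p : Subset k) → weight p ≢ 0 → Nonempty p
    from []          p≢0 = ⊥-elim (p≢0 refl)
    from (true  ∷ p) _   = zero , here
    from (false ∷ p) p≢0 = let (i , i∈p) = from p p≢0 in suc i , there i∈p

  𝟙-all-nonempty : ∀ {j k} (B : Vec (Subset k) j) → 𝟙 (all? nonempty? B) ≡ nonzeroRows B
  𝟙-all-nonempty []      = refl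
  𝟙-all-nonempty (p ∷ B) = trans (𝟙-× (nonempty? p) (all? nonempty? B))
    (cong₂ _*_ (𝟙≡[≢0] (Nonempty⇔weight≢0 p) (nonempty? p)) (𝟙-all-nonempty B))

  allOne : ∀ {k} → Vec ℕ k → ℕ
  allOne u = 𝟙 (all? (_≟ 1) u)

  𝟙-isBallot : ∀ {j k} (B : Vec (Subset k) j) → 𝟙 (isBallot? B) ≡ nonzeroRows B * allOne (colSums B)
  𝟙-isBallot B = begin
    𝟙 (isBallot? B)
      ≡⟨ 𝟙-⇔ (IsBallot⇔ B) (isBallot? B) (all? nonempty? B ×-dec all? (_≟ 1) (colSums B)) ⟩
    𝟙 (all? nonempty? B ×-dec all? (_≟ 1) (colSums B))
      ≡⟨ 𝟙-× (all? nonempty? B) (all? (_≟ 1) (colSums B)) ⟩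
    𝟙 (all? nonempty? B) * allOne (colSums B)
      ≡⟨ cong (_* allOne (colSums B)) (𝟙-all-nonempty B) ⟩
    nonzeroRows B * allOne (colSums B) ∎
    where open ≡-Reasoning

  ballotCount≡∑ : ∀ k j → ballotCount k j ≡ ∑[ B ∈ Matrices bools j k ] (nonzeroRows B * allOne (colSums B))
  ballotCount≡∑ k j = trans (length-filter≡∑𝟙 isBallot? (allSubsetSeqs k j)) (∑-cong (Matrices bools j k) 𝟙-isBallot)

  ∑-𝟙[weight≟1] : ∀ m → ∑[ v ∈ vecsOver bools m ] 𝟙 (weight v ≟ 1) ≡ m
  ∑-𝟙[weight≟1] zero    = refl
  ∑-𝟙[weight≟1] (suc m) = begin
    ∑[ v ∈ vecsOver bools (suc m) ] 𝟙 (weight v ≟ 1)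
      ≡⟨ ∑-vecsOver bools m _ ⟩
    ∑[ v ∈ vecsOver bools m ] 𝟙 (weight v ≟ 0) + (∑[ v ∈ vecsOver bools m ] 𝟙 (weight v ≟ 1) + 0)
      ≡⟨ cong₂ _+_ (trans (∑-cong (vecsOver bools m) (λ v → 𝟙[≟0]≡[≡0] (weight v))) (∑-[weight≡0] refl m))
                   (trans (+-identityʳ _) (∑-𝟙[weight≟1] m)) ⟩
    suc m ∎
    where open ≡-Reasoning

  ∑-allOne-weights : ∀ k m → ∑[ B ∈ Matrices bools k m ] allOne (Vec.map weight B) ≡ m ^ k
  ∑-allOne-weights zero    m = refl
  ∑-allOne-weights (suc k) m = begin
    ∑[ B ∈ Matrices bools (suc k) m ] allOne (Vec.map weight B)
      ≡⟨ ∑-vecsOver (vecsOver bools m) k _ ⟩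
    ∑[ v ∈ vecsOver bools m ] ∑[ B ∈ Matrices bools k m ] allOne (weight v ∷ Vec.map weight B)
      ≡⟨ ∑-cong (vecsOver bools m) (λ v → ∑-cong (Matrices bools k m)
           (λ B → 𝟙-× (weight v ≟ 1) (all? (_≟ 1) (Vec.map weight B)))) ⟩
    ∑[ v ∈ vecsOver bools m ] ∑[ B ∈ Matrices bools k m ] (𝟙 (weight v ≟ 1) * allOne (Vec.map weight B))
      ≡⟨ ∑-cong (vecsOver bools m) (λ v → trans (∑-*ˡ (Matrices bools k m) (𝟙 (weight v ≟ 1)) _)
                                                (cong (𝟙 (weight v ≟ 1) *_) (∑-allOne-weights k m))) ⟩
    ∑[ v ∈ vecsOver bools m ] (𝟙 (weight v ≟ 1) * m ^ k)
      ≡⟨ trans (∑-*ʳ (vecsOver bools m) _ _) (cong (_* m ^ k) (∑-𝟙[weight≟1] m)) ⟩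
    m * m ^ k ∎
    where open ≡-Reasoning

  -- Grouping the maps [k] → [m] by their image: a surjection onto a j-subset of [m] is a ballot with j blocks.
  binomialTransform-ballotCount : ∀ k m → binomialTransform (ballotCount k) m ≡ m ^ k
  binomialTransform-ballotCount k m = begin
    binomialTransform (ballotCount k) m
      ≡⟨ binomialTransform-cong (ballotCount≡∑ k) m ⟩
    binomialTransform (λ j → ∑[ B ∈ Matrices bools j k ] (nonzeroRows B * allOne (colSums B))) m
      ≡⟨ ∑-colSums≡binomialTransform refl m k allOne ⟨
    ∑[ B ∈ Matrices bools m k ] allOne (colSums B)
      ≡⟨ ∑-transpose bools m k _ ⟩
    ∑[ B ∈ Matrices bools k m ] allOne (colSums (transpose B))
      ≡⟨ ∑-cong (Matrices bools k m) (λ B → cong allOne (colSums-transpose B)) ⟩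
    ∑[ B ∈ Matrices bools k m ] allOne (Vec.map weight B)
      ≡⟨ ∑-allOne-weights k m ⟩
    m ^ k ∎
    where open ≡-Reasoning

module BurgeMatrices (n : ℕ) where

  open import Data.Vec.Relation.Unary.Any using (here; there; any?)

  open WeightedMatrices (range n) id

  weight≡sum : ∀ {c} (v : Vec ℕ c) → weight v ≡ Vec.sum v
  weight≡sum v = cong Vec.sum (map-id v)

  total≡size : ∀ {r c} (B : Matrix r c) → total B ≡ size B
  total≡size B = trans (total≡sum-weights B) (cong Vec.sum (map-cong weight≡sum B))

  size≡sum-concat : ∀ {r c} (B : Matrix r c) → size B ≡ Vec.sum (concat B)
  size≡sum-concat []      = refl
  size≡sum-concat (v ∷ B) = trans (cong (Vec.sum v +_) (size≡sum-concat B)) (sym (sum-++ v))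

  HasNonzero⇔weight≢0 : ∀ {c} (v : Vec ℕ c) → HasNonzero v ⇔ (weight v ≢ 0)
  HasNonzero⇔weight≢0 v = mk⇔ (λ v≢0 → subst (_≢ 0) (sym (weight≡sum v)) (to v v≢0))
                               (λ v≢0 → from v (subst (_≢ 0) (weight≡sum v) v≢0))
    where
    to : ∀ {c} (v : Vec ℕ c) → HasNonzero v → Vec.sum v ≢ 0
    to (x ∷ v) (here  x≢0) = x≢0 ∘ m+n≡0⇒m≡0 x
    to (x ∷ v) (there v≢0) = to v v≢0 ∘ m+n≡0⇒n≡0 x

    from : ∀ {c} (v : Vec ℕ c) → Vec.sum v ≢ 0 → HasNonzero v
    from []          v≢0 = ⊥-elim (v≢0 refl)
    from (zero  ∷ v) v≢0 = there (from v v≢0)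
    from (suc x ∷ v) _   = here (λ ())

  hasNonzero? : ∀ {c} (v : Vec ℕ c) → Dec (HasNonzero v)
  hasNonzero? = any? (λ x → ¬? (x ≟ 0))

  𝟙-all-hasNonzero : ∀ {r c} (B : Matrix r c) → 𝟙 (all? hasNonzero? B) ≡ nonzeroRows B
  𝟙-all-hasNonzero []      = refl
  𝟙-all-hasNonzero (v ∷ B) = trans (𝟙-× (hasNonzero? v) (all? hasNonzero? B))
    (cong₂ _*_ (𝟙≡[≢0] (HasNonzero⇔weight≢0 v) (hasNonzero? v)) (𝟙-all-hasNonzero B))

  𝟙-isBurge : ∀ {r c} (B : Matrix r c) → 𝟙 (isBurge? n B) ≡ nonzeroRows B * nonzeroCols B * 𝟙 (total B ≟ n)
  𝟙-isBurge B = begin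
    𝟙 (isBurge? n B)
      ≡⟨ 𝟙-× (all? hasNonzero? B ×-dec all? hasNonzero? (transpose B)) (size B ≟ n) ⟩
    𝟙 (all? hasNonzero? B ×-dec all? hasNonzero? (transpose B)) * 𝟙 (size B ≟ n)
      ≡⟨ cong (_* 𝟙 (size B ≟ n)) (𝟙-× (all? hasNonzero? B) (all? hasNonzero? (transpose B))) ⟩
    𝟙 (all? hasNonzero? B) * 𝟙 (all? hasNonzero? (transpose B)) * 𝟙 (size B ≟ n)
      ≡⟨ cong₂ (λ a b → a * b * 𝟙 (size B ≟ n)) (𝟙-all-hasNonzero B)
                 (trans (𝟙-all-hasNonzero (transpose B)) (nonzeroRows-transpose B)) ⟩
    nonzeroRows B * nonzeroCols B * 𝟙 (size B ≟ n)
      ≡⟨ cong (λ s → nonzeroRows B * nonzeroCols B * 𝟙 (s ≟ n)) (total≡size B) ⟨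
    nonzeroRows B * nonzeroCols B * 𝟙 (total B ≟ n) ∎
    where open ≡-Reasoning

  burgeCount≡∑ : ∀ r c → burgeCount n r c ≡ ∑[ B ∈ Matrices (range n) r c ] (nonzeroRows B * nonzeroCols B * 𝟙 (total B ≟ n))
  burgeCount≡∑ r c = trans (length-filter≡∑𝟙 (isBurge? n) (boundedMatrices n r c)) (∑-cong (Matrices (range n) r c) 𝟙-isBurge)

  factorial*binomialTransform₂-burgeCount : ∀ r c → n ! * binomialTransform₂ (burgeCount n) r c ≡ rising (r * c) n
  factorial*binomialTransform₂-burgeCount r c = begin
    n ! * binomialTransform₂ (burgeCount n) r c
      ≡⟨ cong (n ! *_) (binomialTransform₂-cong burgeCount≡∑ r c) ⟩
    n ! * binomialTransform₂ (λ i j → ∑[ B ∈ Matrices (range n) i j ] (nonzeroRows B * nonzeroCols B * 𝟙 (total B ≟ n))) r c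
      ≡⟨ cong (n ! *_) (∑-total≡binomialTransform₂ (range-uniqueZero n) r c (λ t → 𝟙 (t ≟ n))) ⟨
    n ! * ∑[ B ∈ Matrices (range n) r c ] 𝟙 (total B ≟ n)
      ≡⟨ cong (n ! *_) (∑-cong (Matrices (range n) r c)
           (λ B → cong (λ s → 𝟙 (s ≟ n)) (trans (total≡size B) (size≡sum-concat B)))) ⟩
    n ! * ∑[ B ∈ Matrices (range n) r c ] 𝟙 (Vec.sum (concat B) ≟ n)
      ≡⟨ cong (n ! *_) (∑-Matrices-concat (range n) r c (λ v → 𝟙 (Vec.sum v ≟ n))) ⟩
    n ! * compositions n n (r * c)
      ≡⟨ factorial*compositions (r * c) n ≤-refl ⟩
    rising (r * c) n ∎
    where open ≡-Reasoning

theorem4p8 : (n r c : ℕ) →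
    (n !) * burgeCount n r c
      ≡ sumTo n (λ k → stirling1 n k * ballotCount k r * ballotCount k c)
theorem4p8 n r c = begin
  n ! * burgeCount n r c
    ≡⟨ binomialTransform₂-injective transformsAgree r c ⟩
  stirlingBallots r c
    ≡⟨ sumTo≡∑≤ n _ ⟨
  sumTo n (λ k → stirling1 n k * ballotCount k r * ballotCount k c) ∎
  where
  open ≡-Reasoning
  open Ballots using (binomialTransform-ballotCount)
  open BurgeMatrices n using (factorial*binomialTransform₂-burgeCount)

  stirlingBallots : ℕ → ℕ → ℕ
  stirlingBallots i j = ∑[ k ≤ n ] (stirling1 n k * ballotCount k i * ballotCount k j)

  transformsAgree : ∀ r c → binomialTransform₂ (λ i j → n ! * burgeCount n i j) r c
                          ≡ binomialTransform₂ stirlingBallots r c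
  transformsAgree r c = begin
    binomialTransform₂ (λ i j → n ! * burgeCount n i j) r c
      ≡⟨ binomialTransform₂-*ˡ (n !) (burgeCount n) r c ⟩
    n ! * binomialTransform₂ (burgeCount n) r c
      ≡⟨ factorial*binomialTransform₂-burgeCount r c ⟩
    rising (r * c) n
      ≡⟨ ∑-stirling1-pow n (r * c) ⟨
    ∑[ k ≤ n ] (stirling1 n k * (r * c) ^ k)
      ≡⟨ ∑≤-cong n (λ k → trans (cong (stirling1 n k *_) (^-distribʳ-* r c k)) (sym (*-assoc (stirling1 n k) _ _))) ⟩
    ∑[ k ≤ n ] (stirling1 n k * r ^ k * c ^ k)
      ≡⟨ ∑≤-cong n (λ k → cong₂ (λ x y → stirling1 n k * x * y)
                                (binomialTransform-ballotCount k r) (binomialTransform-ballotCount k c)) ⟨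
    ∑[ k ≤ n ] (stirling1 n k * binomialTransform (ballotCount k) r * binomialTransform (ballotCount k) c)
      ≡⟨ binomialTransform₂-separable n (stirling1 n) ballotCount ballotCount r c ⟨
    binomialTransform₂ stirlingBallots r c ∎
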